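{- Let $F$ be a flipclass of $\mathfrak S_n$ (of paths of length $h$), let $E=E(F)$ and $m=|E|$. Then: (1) the set $F'=\{r_E(\Gamma):\Gamma\in F\}$ is a flipclass of $\mathfrak S_m$, and $r_E$ is a bijection $F\to F'$ commuting with the flip operators and satisfying $r_E(l_i(\Gamma))=l_i(r_E(\Gamma))$ for all $\Gamma\in F$ and $i\in[h]$, where $l_i(\Delta)$ is the $i$-th label of $\Delta$; (2) $r_E$ induces isomorphisms of edge-labelled directed graphs $S_F\to S_{F'}$ and $TS_F\to TS_{F'}$, under which labels correspond via $r_E$; (3) for any reflection ordering $\preceq$ of $\mathfrak S_n$, the increasing paths of $F$, $S_F$ and $TS_F$ with respect to $\preceq$ correspond to the increasing paths of $F'$, $S_{F'}$ and $TS_{F'}$ respectively with respect to $\preceq_{r_E}$; (4) $r_E$ induces an isomorphism from $F$ to $F'$.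
   Context: $\mathfrak S_n$: symmetric group on $[n]$, $\ell$ Coxeter length, $T$ transpositions. Bruhat graph $B(\mathfrak S_n)$: edge $x\xrightarrow{t}y$ labelled $t$ whenever $yx^{ -1}=t\in T$ and $\ell(x)<\ell(y)$. Between two elements there are 0 or 2 paths of length 2, each the flip of the other; $f_i$ replaces the subpath $x_{i-1}\to x_i\to x_{i+1}$ of a path by its flip; a flipclass is an orbit in the set $P_h(u,v)$ of length-$h$ paths from $u$ to $v$ of the group generated by $f_1,\dots,f_{h-1}$. $E(F)$ is the set of $a\in[n]$ moved by some transposition labelling an edge of $\Gamma$, for any $\Gamma\in F$ (independent of $\Gamma$). $r_E:E\to[m]$ is the unique order-preserving bijection; for $w\in\mathfrak S_n$, $r_E(w)\in\mathfrak S_m$ is obtained from the one-line notation of $w$ by deleting the entries not in $E$ and applying $r_E$ to the remaining entries; for a path $\Gamma$ whose labels are transpositions $(a,b)$ with $a,b\in E$, $r_E(\Gamma)$ is the path in $B(\mathfrak S_m)$ obtained by applying $r_E$ to its vertices and labels; for a total order $\preceq$ on transpositions of $\mathfrak S_n$, $\preceq_{r_E}$ is the order on transpositions of $\mathfrak S_m$ with $(a,b)\preceq_{r_E}(c,d)$ iff $(r_E^{ -1}(a),r_E^{ -1}(b))\preceq(r_E^{ -1}(c),r_E^{ -1}(d))$. $S_F$: subgraph of $B(\mathfrak S_n)$ of vertices and edges of paths of $F$; $TS_F$: vertices $(a,i)$ with $x_i=a$ for some path of $F$, edges $(a,i)\xrightarrow{t}(b,i+1)$ whenever some path of $F$ has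 $x_i=a,x_{i+1}=b$ with that edge labelled $t$. A reflection ordering is a total order $\preceq$ on $T$ with, for all $a<b<c$, $(a,b)\preceq(a,c)\preceq(b,c)$ or $(b,c)\preceq(a,c)\preceq(a,b)$; increasing means labels weakly increasing. An isomorphism from a flipclass $F$ of $\mathfrak S_n$ to a flipclass $F'$ of $\mathfrak S_m$ (same length $h$) is a pair $(f,g)$: $f$ a bijection between the sets of permutations occurring in paths of $F$ and of $F'$ mapping paths to paths and inducing a bijection $F\to F'$ commuting with all flip operators; $g$ a bijection between the sets of transpositions labelling paths of $F$ and of $F'$, with $f(\Gamma)$ having label sequence $(g(t_1),\dots,g(t_h))$ when $\Gamma$ has $(t_1,\dots,t_h)$, and $g$ order preserving for the lexicographic orders $(1,2)\prec(1,3)\prec\cdots\prec(2,3)\prec\cdots$. -}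

module Defs where

open import Data.Nat using (ℕ; zero; suc; _+_; _<_; _≤_; _≡ᵇ_; _<ᵇ_)
open import Data.Bool using (Bool; true; false; if_then_else_; _∨_)
open import Data.Fin using (Fin; toℕ; inject₁)
import Data.Fin as Fin
open import Data.List using (List; []; _∷_; map; filterᵇ; length; upTo)
open import Data.Bool.ListAction using (any)
open import Data.List.Relation.Binary.Permutation.Propositional using (_↭_)
open import Data.Vec using (Vec; lookup; toList)
import Data.Vec as Vec
open import Data.Product using (Σ; ∃; _×_; _,_; proj₁)
open import Data.Sum using (_⊎_)
open import Data.Unit using (⊤)
open import Relation.Binary.PropositionalEquality using (_≡_; _≢_)
open import Relation.Binary.Construct.Closure.ReflexiveTransitive using (Star)
open import Function using (_∘_)
open import Function.Bundles using (_⇔_)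

-- Conventions.  [n] is taken 0-based: {0,…,n-1}.  A permutation
-- w ∈ 𝔖ₙ is given by its one-line notation, a list of naturals that is
-- a rearrangement of [0,…,n-1].

IsPerm : ℕ → List ℕ → Set
IsPerm n w = w ↭ upTo n

-- Coxeter length of a permutation = number of inversions.
inv : List ℕ → ℕ
inv []       = 0
inv (x ∷ xs) = length (filterᵇ (λ y → y <ᵇ x) xs) + inv xs

-- A transposition (a,b), intended with a < b.
record Tr : Set where
  constructor tr
  field
    a : ℕ
    b : ℕ
open Tr public

ValidTr : ℕ → Tr → Set
ValidTr n t = a t < b t × b t < n

swap : Tr → ℕ → ℕ
swap t x = if x ≡ᵇ a t then b t else (if x ≡ᵇ b t then a t else x)

-- left multiplication t·x  (one-line notation: swap the values a,b)
_·_ : Tr → List ℕ → List ℕ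
t · x = map (swap t) x

-- Bruhat graph edge  x --t--> y  in B(𝔖ₙ):  y x⁻¹ = t and ℓ(x) < ℓ(y)
Edge : ℕ → List ℕ → Tr → List ℕ → Set
Edge n x t y = ValidTr n t × y ≡ t · x × inv x < inv y

-- Paths of length h: vertices x₀,…,x_h and labels t₁,…,t_h
-- (stored 0-based: label k labels the edge x_k → x_{k+1}).

record Path (h : ℕ) : Set where
  constructor path
  field
    vs : Vec (List ℕ) (suc h)
    ls : Vec Tr h
open Path public

IsPath : ℕ → {h : ℕ} → Path h → Set
IsPath n {h} Γ =
  IsPerm n (Vec.head (vs Γ)) ×
  ((i : Fin h) → Edge n (lookup (vs Γ) (inject₁ i)) (lookup (ls Γ) i) (lookup (vs Γ) (Fin.suc i)))

-- FlipAt n Γ Γ' j :  Γ' = f_j(Γ)  (1 ≤ j ≤ h-1): Γ' is the path obtained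
-- by replacing the subpath x_{j-1} → x_j → x_{j+1} of Γ by its flip,
-- i.e. by the other length-2 path between x_{j-1} and x_{j+1}.
FlipAt : ℕ → {h : ℕ} → Path h → Path h → ℕ → Set
FlipAt n {h} Γ Γ' j =
  1 ≤ j × j < h × IsPath n Γ × IsPath n Γ' ×
  ((k : Fin (suc h)) → toℕ k ≢ j → lookup (vs Γ') k ≡ lookup (vs Γ) k) ×
  ((k : Fin h) → toℕ k ≢ j → suc (toℕ k) ≢ j → lookup (ls Γ') k ≡ lookup (ls Γ) k) ×
  (Σ (Fin (suc h)) λ k → toℕ k ≡ j × lookup (vs Γ') k ≢ lookup (vs Γ) k)

FlipStep : ℕ → {h : ℕ} → Path h → Path h → Set
FlipStep n Γ Γ' = Σ ℕ (FlipAt n Γ Γ')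

-- The flipclass of a path Γ₀ (its orbit under ⟨f₁,…,f_{h-1}⟩), as a
-- predicate on paths.  (Each f_j is an involution, so the orbit is the
-- reflexive-transitive closure of single flips.)
Flipclass : ℕ → {h : ℕ} → Path h → Path h → Set
Flipclass n Γ₀ Γ = Star (FlipStep n) Γ₀ Γ

-- E(F), computed from a representative Γ₀, as a sorted list.

movesᵇ : ℕ → Tr → Bool
movesᵇ x t = (x ≡ᵇ a t) ∨ (x ≡ᵇ b t)

Elist : ℕ → {h : ℕ} → Path h → List ℕ
Elist n Γ₀ = filterᵇ (λ x → any (movesᵇ x) (toList (ls Γ₀))) (upTo n)

rE : List ℕ → ℕ → ℕ
rE E x = length (filterᵇ (λ y → y <ᵇ x) E)

-- r_E⁻¹ : [m] → E  (k-th element of the sorted list E)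
nth : List ℕ → ℕ → ℕ
nth []       _       = 0
nth (x ∷ xs) zero    = x
nth (x ∷ xs) (suc k) = nth xs k

_∈ᵇ_ : ℕ → List ℕ → Bool
x ∈ᵇ E = any (λ y → y ≡ᵇ x) E

rPerm : List ℕ → List ℕ → List ℕ
rPerm E w = map (rE E) (filterᵇ (λ x → x ∈ᵇ E) w)

rTr : List ℕ → Tr → Tr
rTr E t = tr (rE E (a t)) (rE E (b t))

mapPath : {h : ℕ} → (List ℕ → List ℕ) → (Tr → Tr) → Path h → Path h
mapPath f g Γ = path (Vec.map f (vs Γ)) (Vec.map g (ls Γ))

rPath : List ℕ → {h : ℕ} → Path h → Path h
rPath E = mapPath (rPerm E) (rTr E)

Image : {h : ℕ} → (Path h → Path h) → (Path h → Set) → Path h → Set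
Image φ F Δ = ∃ λ Γ → F Γ × φ Γ ≡ Δ

-- S_F and TS_F for a set F of paths of length h.

VS : {h : ℕ} → (Path h → Set) → List ℕ → Set
VS {h} F x = ∃ λ Γ → F Γ × Σ (Fin (suc h)) λ k → lookup (vs Γ) k ≡ x

LS : {h : ℕ} → (Path h → Set) → Tr → Set
LS {h} F t = ∃ λ Γ → F Γ × Σ (Fin h) λ k → lookup (ls Γ) k ≡ t

ES : {h : ℕ} → (Path h → Set) → List ℕ → Tr → List ℕ → Set
ES {h} F x t y = ∃ λ Γ → F Γ × Σ (Fin h) λ i →
  lookup (vs Γ) (inject₁ i) ≡ x × lookup (ls Γ) i ≡ t × lookup (vs Γ) (Fin.suc i) ≡ y

TVS : {h : ℕ} → (Path h → Set) → List ℕ × ℕ → Set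
TVS {h} F (x , i) = ∃ λ Γ → F Γ × Σ (Fin (suc h)) λ k → toℕ k ≡ i × lookup (vs Γ) k ≡ x

TES : {h : ℕ} → (Path h → Set) → List ℕ × ℕ → Tr → List ℕ × ℕ → Set
TES {h} F (x , i) t (y , j) = j ≡ suc i × (∃ λ Γ → F Γ × Σ (Fin h) λ k → toℕ k ≡ i ×
  lookup (vs Γ) (inject₁ k) ≡ x × lookup (ls Γ) k ≡ t × lookup (vs Γ) (Fin.suc k) ≡ y)

-- a (directed) path in an edge-labelled digraph, starting at x, given by
-- its list of steps (label , next vertex)
Walk : {V : Set} → (V → Tr → V → Set) → V → List (Tr × V) → Set
Walk E x []             = ⊤
Walk E x ((t , y) ∷ st) = E x t y × Walk E y st

record ReflectionOrdering (n : ℕ) (_≼_ : Tr → Tr → Set) : Set where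
  field
    refl′   : ∀ t → ValidTr n t → t ≼ t
    antisym : ∀ t u → ValidTr n t → ValidTr n u → t ≼ u → u ≼ t → t ≡ u
    trans′  : ∀ t u v → ValidTr n t → ValidTr n u → ValidTr n v → t ≼ u → u ≼ v → t ≼ v
    total   : ∀ t u → ValidTr n t → ValidTr n u → t ≼ u ⊎ u ≼ t
    reflect : ∀ x y z → x < y → y < z → z < n →
      (tr x y ≼ tr x z × tr x z ≼ tr y z) ⊎ (tr y z ≼ tr x z × tr x z ≼ tr x y)

pullback : List ℕ → (Tr → Tr → Set) → Tr → Tr → Set
pullback E _≼_ t u = tr (nth E (a t)) (nth E (b t)) ≼ tr (nth E (a u)) (nth E (b u))

Increasing : (Tr → Tr → Set) → List Tr → Set
Increasing _≼_ []            = ⊤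
Increasing _≼_ (t ∷ [])      = ⊤
Increasing _≼_ (t ∷ u ∷ ts)  = t ≼ u × Increasing _≼_ (u ∷ ts)

IncPath : (Tr → Tr → Set) → {h : ℕ} → Path h → Set
IncPath _≼_ Γ = Increasing _≼_ (toList (ls Γ))

LexLe : Tr → Tr → Set
LexLe t u = a t < a u ⊎ (a t ≡ a u × b t ≤ b u)

record FlipclassIso (n m : ℕ) {h : ℕ} (F F' : Path h → Set)
                    (f : List ℕ → List ℕ) (g : Tr → Tr) : Set where
  field
    f-inj  : ∀ x y → VS F x → VS F y → f x ≡ f y → x ≡ y
    f-onto : ∀ x' → VS F' x' ⇔ (∃ λ x → VS F x × f x ≡ x')
    g-inj  : ∀ t u → LS F t → LS F u → g t ≡ g u → t ≡ u
    g-onto : ∀ t' → LS F' t' ⇔ (∃ λ t → LS F t × g t ≡ t')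
    paths  : ∀ Γ → F Γ → F' (mapPath f g Γ)
    p-inj  : ∀ Γ Δ → F Γ → F Δ → mapPath f g Γ ≡ mapPath f g Δ → Γ ≡ Δ
    p-onto : ∀ Δ → F' Δ → ∃ λ Γ → F Γ × mapPath f g Γ ≡ Δ
    flips  : ∀ Γ Γ' j → F Γ → FlipAt n Γ Γ' j → FlipAt m (mapPath f g Γ) (mapPath f g Γ') j
    g-mono : ∀ t u → LS F t → LS F u → LexLe t u → LexLe (g t) (g u)

-- E is read off Γ₀, but every label of every path in F moves only values of E: a flip replaces
-- labels t₁, t₂ by t₁′, t₂′ with t₂′ t₁′ = t₂ t₁, and for distinct transpositions the support
-- of the product is the union of the supports.  So all vertices of F agree with the start x₀
-- outside E, where r_E (delete the values outside E, then rank) is injective, and it turns left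
-- multiplication by t into left multiplication by r_E(t).  Whether x → t x is an edge of B(𝔖ₙ)
-- depends only on whether a t occurs before b t in x, which r_E preserves; hence r_E maps paths
-- to paths and flips to flips, and conversely each path of B(𝔖ₘ) from r_E x₀ lifts, by the
-- labels r_E⁻¹ t, to a path from x₀.  Thus r_E is a flip-compatible bijection F → F′ with
-- injective vertex and label maps, and (1)–(4) follow.

module Submission where

open import Defs
open import Data.Bool using (Bool; true; false; T)
open import Data.Bool.Properties using (T-≡; T-∨)
open import Data.Bool.ListAction using (any)
open import Data.Empty using (⊥-elim)
open import Data.Fin using (Fin; zero; suc; toℕ; inject₁; fromℕ<)
open import Data.Fin.Induction using (<-weakInduction)
open import Data.Fin.Properties using (toℕ-injective; toℕ-inject₁; toℕ-fromℕ<)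
open import Data.List using (List; []; _∷_; [_]; _++_; map; filterᵇ; length; upTo; applyUpTo)
open import Data.List.Properties
  using (∷-injective; ∷-injectiveˡ; ∷-injectiveʳ; length-++; map-++; map-∘; map-id; map-cong; map-cong-local;
         map-id-local; map-upTo; filter-accept; filter-reject; filter-++; filter-none; filter-notAll)
open import Data.List.Membership.Propositional using (_∈_; _∉_)
open import Data.List.Membership.Propositional.Properties using (∈-filter⁺; ∈-filter⁻; ∈-map⁺; ∈-upTo⁺; ∈-upTo⁻)
open import Data.List.Relation.Binary.Pointwise using (Pointwise; []; _∷_)
import Data.List.Relation.Binary.Pointwise as Pointwise
open import Data.List.Relation.Binary.Permutation.Propositional
  using (_↭_; ↭-sym; ↭⇒↭ₛ; module PermutationReasoning)
open import Data.List.Relation.Binary.Permutation.Propositional.Properties using (filter-↭; ∈-resp-↭; map⁺)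
open import Data.List.Relation.Unary.All using (All; []; _∷_)
import Data.List.Relation.Unary.All as All
open import Data.List.Relation.Unary.All.Properties using (++⁻ˡ; ++⁻ʳ)
open import Data.List.Relation.Unary.AllPairs using (AllPairs; []; _∷_)
import Data.List.Relation.Unary.AllPairs.Properties as AllPairs
open import Data.List.Relation.Unary.Any using (Any; here; there)
import Data.List.Relation.Unary.Any as Any
open import Data.List.Relation.Unary.Any.Properties using (any⁺; any⁻)
open import Data.List.Relation.Unary.Unique.Propositional using (Unique)
import Data.List.Relation.Unary.Unique.Propositional.Properties as Unique
open import Data.Nat using (ℕ; zero; suc; _+_; _<_; _≤_; _≡ᵇ_; _<ᵇ_; z≤n; s≤s; s<s)
open import Data.Nat.Properties
open import Data.List.Membership.DecPropositional _≟_ using (_∈?_)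
open import Data.Nat.Tactic.RingSolver using (solve-∀)
open import Data.Product using (Σ; ∃; ∃₂; _×_; _,_; proj₁; proj₂)
import Data.Product as Prod
open import Data.Product.Function.NonDependent.Propositional using (_×-⇔_)
open import Data.Sum using (_⊎_; inj₁; inj₂)
import Data.Sum as Sum
open import Data.Vec using (Vec; []; _∷_; lookup; toList)
import Data.Vec as Vec
open import Data.Vec.Membership.Propositional.Properties using (∈-lookup; ∈-toList⁺)
open import Data.Vec.Properties using (lookup-map; toList-map; tabulate∘lookup; tabulate-cong)
open import Data.Vec.Relation.Unary.All.Properties using (lookup⁻; toList⁺)
open import Function using (id; _∘_; _⇔_; mk⇔; Equivalence)
open import Relation.Binary.Construct.Closure.ReflexiveTransitive using (Star; ε; _◅_)
open import Relation.Binary.Definitions using (tri<; tri≈; tri>)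
open import Relation.Binary.PropositionalEquality hiding ([_])
open import Data.List.Relation.Binary.Permutation.Setoid.Properties (setoid ℕ) using (Unique-resp-↭)
open import Relation.Nullary using (¬_; yes; no)
open import Relation.Nullary.Decidable using (T?)

open Equivalence using (to; from)

∈ᵇ⇒∈ : ∀ {x} E → T (x ∈ᵇ E) → x ∈ E
∈ᵇ⇒∈ {x} E p = Any.map (λ {y} q → sym (≡ᵇ⇒≡ y x q)) (any⁻ _ E p)

∈⇒∈ᵇ : ∀ {x E} → x ∈ E → T (x ∈ᵇ E)
∈⇒∈ᵇ {x} x∈E = any⁺ _ (Any.map (λ {y} q → ≡⇒≡ᵇ y x (sym q)) x∈E)

≡ᵇ-≢ : ∀ {x y} → x ≢ y → (x ≡ᵇ y) ≡ false
≡ᵇ-≢ {x} {y} x≢y with x ≡ᵇ y in eq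
... | true  = ⊥-elim (x≢y (≡ᵇ⇒≡ x y (from T-≡ eq)))
... | false = refl

≡ᵇ-refl : ∀ x → (x ≡ᵇ x) ≡ true
≡ᵇ-refl x = to T-≡ (≡⇒≡ᵇ x x refl)

map-≡⇒≡ : ∀ {f g : ℕ → ℕ} {xs v} → map f xs ≡ map g xs → v ∈ xs → f v ≡ g v
map-≡⇒≡ eq (here refl) = ∷-injectiveˡ eq
map-≡⇒≡ eq (there v∈) = map-≡⇒≡ (∷-injectiveʳ eq) v∈

filterᵇ-cong-local : ∀ (p q : ℕ → Bool) {xs} → All (λ x → T (p x) ⇔ T (q x)) xs → filterᵇ p xs ≡ filterᵇ q xs
filterᵇ-cong-local p q []                 = refl
filterᵇ-cong-local p q {x ∷ xs} (px⇔qx ∷ rest) with p x | q x | px⇔qx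
... | true  | true  | _     = cong (x ∷_) (filterᵇ-cong-local p q rest)
... | false | false | _     = filterᵇ-cong-local p q rest
... | true  | false | px⇒qx = ⊥-elim (to px⇒qx _)
... | false | true  | qx⇒px = ⊥-elim (from qx⇒px _)

-- Ranks

rE-++ : ∀ L M x → rE (L ++ M) x ≡ rE L x + rE M x
rE-++ L M x = trans (cong length (filter-++ (T? ∘ (_<ᵇ x)) L M)) (length-++ (filterᵇ (_<ᵇ x) L))

rE-∷-< : ∀ {y x} L → y < x → rE (y ∷ L) x ≡ suc (rE L x)
rE-∷-< {x = x} L y<x = cong length (filter-accept (T? ∘ (_<ᵇ x)) (<⇒<ᵇ y<x))

rE-∷-≥ : ∀ {y x} L → x ≤ y → rE (y ∷ L) x ≡ rE L x
rE-∷-≥ {y} {x} L x≤y = cong length (filter-reject (T? ∘ (_<ᵇ x)) (λ y<x → ≤⇒≯ x≤y (<ᵇ⇒< y x y<x)))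

rE-∷ : ∀ u L x → rE (u ∷ L) x ≡ rE [ u ] x + rE L x
rE-∷ u = rE-++ [ u ]

rE-[]-monoʳ : ∀ u {x y} → x ≤ y → rE [ u ] x ≤ rE [ u ] y
rE-[]-monoʳ u {x} {y} x≤y with u <? x
... | yes u<x rewrite rE-∷-< [] u<x | rE-∷-< [] (<-≤-trans u<x x≤y) = ≤-refl
... | no  u≮x rewrite rE-∷-≥ [] (≮⇒≥ u≮x) = z≤n

rE-[]-antiˡ : ∀ {u v} x → u ≤ v → rE [ v ] x ≤ rE [ u ] x
rE-[]-antiˡ {u} {v} x u≤v with v <? x
... | yes v<x rewrite rE-∷-< [] v<x | rE-∷-< [] (≤-<-trans u≤v v<x) = ≤-refl
... | no  v≮x rewrite rE-∷-≥ [] (≮⇒≥ v≮x) = z≤n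

rE-mono : ∀ L {x y} → x ≤ y → rE L x ≤ rE L y
rE-mono []      x≤y = z≤n
rE-mono (u ∷ L) {x} {y} x≤y rewrite rE-∷ u L x | rE-∷ u L y =
  +-mono-≤ (rE-[]-monoʳ u x≤y) (rE-mono L x≤y)

rE-strict : ∀ {L x y} → x ∈ L → x < y → rE L x < rE L y
rE-strict {x ∷ L} {x} {y} (here refl) x<y rewrite rE-∷-≥ L (≤-refl {x}) | rE-∷-< L x<y =
  s≤s (rE-mono L (<⇒≤ x<y))
rE-strict {u ∷ L} {x} {y} (there x∈L) x<y rewrite rE-∷ u L x | rE-∷ u L y =
  +-mono-≤-< (rE-[]-monoʳ u (<⇒≤ x<y)) (rE-strict x∈L x<y)

rE-injective : ∀ {L x y} → x ∈ L → y ∈ L → rE L x ≡ rE L y → x ≡ y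
rE-injective x∈L y∈L eq with <-cmp _ _
... | tri< x<y _ _ = ⊥-elim (<-irrefl eq (rE-strict x∈L x<y))
... | tri≈ _ x≡y _ = x≡y
... | tri> _ _ y<x = ⊥-elim (<-irrefl (sym eq) (rE-strict y∈L y<x))

rE-<-length : ∀ {L x} → x ∈ L → rE L x < length L
rE-<-length {L} {x} x∈L =
  filter-notAll (T? ∘ (_<ᵇ x)) L (Any.map (λ { refl x<x → <-irrefl refl (<ᵇ⇒< x x x<x) }) x∈L)

-- Inversions

-- inv (x ∷ xs) unfolds to rE xs x + inv xs.

inv-middle : ∀ {a b} → a ≤ b → ∀ q s →
  rE q a + inv (q ++ b ∷ s) + rE s a ≤ rE q b + inv (q ++ a ∷ s) + rE s b
inv-middle {a} {b} a≤b [] s = ≤-reflexive (reverse₃ (rE s b) (inv s) (rE s a))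
  where
  reverse₃ : ∀ x y z → x + y + z ≡ z + y + x
  reverse₃ = solve-∀
inv-middle {a} {b} a≤b (u ∷ q) s = begin
  rE (u ∷ q) a + inv (u ∷ q ++ b ∷ s) + rE s a
    ≡⟨ regroup a b ⟩
  (rE [ u ] a + rE [ b ] u) + (rE q u + rE s u) + (rE q a + inv (q ++ b ∷ s) + rE s a)
    ≤⟨ +-mono-≤ (+-monoˡ-≤ _ (+-mono-≤ (rE-[]-monoʳ u a≤b) (rE-[]-antiˡ u a≤b))) (inv-middle a≤b q s) ⟩
  (rE [ u ] b + rE [ a ] u) + (rE q u + rE s u) + (rE q b + inv (q ++ a ∷ s) + rE s b)
    ≡⟨ regroup b a ⟨
  rE (u ∷ q) b + inv (u ∷ q ++ a ∷ s) + rE s b ∎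
  where
  open ≤-Reasoning
  shuffle : ∀ A B C D F G H → A + B + ((C + (D + F)) + G) + H ≡ (A + D) + (C + F) + (B + G + H)
  shuffle = solve-∀
  regroup : ∀ x y → rE (u ∷ q) x + inv (u ∷ q ++ y ∷ s) + rE s x
                  ≡ (rE [ u ] x + rE [ y ] u) + (rE q u + rE s u) + (rE q x + inv (q ++ y ∷ s) + rE s x)
  regroup x y = trans
    (cong₂ (λ A B → A + (B + inv (q ++ y ∷ s)) + rE s x) (rE-∷ u q x)
           (trans (rE-++ q (y ∷ s) u) (cong (rE q u +_) (rE-∷ y s u))))
    (shuffle (rE [ u ] x) (rE q x) (rE q u) (rE [ y ] u) (rE s u) (inv (q ++ y ∷ s)) (rE s x))

inv-exchange-ends : ∀ {a b} → a < b → ∀ q s → inv (a ∷ q ++ b ∷ s) < inv (b ∷ q ++ a ∷ s)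
inv-exchange-ends {a} {b} a<b q s = begin-strict
  inv (a ∷ q ++ b ∷ s)
    ≡⟨ cong (_+ inv (q ++ b ∷ s)) (trans (rE-++ q (b ∷ s) a) (cong (rE q a +_) (rE-∷-≥ s (<⇒≤ a<b)))) ⟩
  rE q a + rE s a + inv (q ++ b ∷ s)
    ≡⟨ +-shuffle (rE q a) (rE s a) (inv (q ++ b ∷ s)) ⟩
  rE q a + inv (q ++ b ∷ s) + rE s a
    <⟨ s≤s (inv-middle (<⇒≤ a<b) q s) ⟩
  suc (rE q b + inv (q ++ a ∷ s) + rE s b)
    ≡⟨ +-shuffle′ (rE q b) (inv (q ++ a ∷ s)) (rE s b) ⟩
  rE q b + suc (rE s b) + inv (q ++ a ∷ s)
    ≡⟨ cong (_+ inv (q ++ a ∷ s)) (trans (rE-++ q (a ∷ s) b) (cong (rE q b +_) (rE-∷-< s a<b))) ⟨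
  inv (b ∷ q ++ a ∷ s) ∎
  where
  open ≤-Reasoning
  +-shuffle : ∀ x y z → x + y + z ≡ x + z + y
  +-shuffle = solve-∀
  +-shuffle′ : ∀ x y z → suc (x + y + z) ≡ x + suc z + y
  +-shuffle′ = solve-∀

rE-exchange : ∀ a b q s u → rE (a ∷ q ++ b ∷ s) u ≡ rE (b ∷ q ++ a ∷ s) u
rE-exchange a b q s u = begin
  rE (a ∷ q ++ b ∷ s) u                       ≡⟨ expand a b ⟩
  rE [ a ] u + (rE q u + (rE [ b ] u + rE s u)) ≡⟨ swap-outer (rE [ a ] u) (rE [ b ] u) (rE q u) (rE s u) ⟩
  rE [ b ] u + (rE q u + (rE [ a ] u + rE s u)) ≡⟨ expand b a ⟨
  rE (b ∷ q ++ a ∷ s) u                       ∎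
  where
  open ≡-Reasoning
  expand : ∀ x y → rE (x ∷ q ++ y ∷ s) u ≡ rE [ x ] u + (rE q u + (rE [ y ] u + rE s u))
  expand x y = trans (rE-∷ x (q ++ y ∷ s) u)
    (cong (rE [ x ] u +_) (trans (rE-++ q (y ∷ s) u) (cong (rE q u +_) (rE-∷ y s u))))
  swap-outer : ∀ x y z w → x + (z + (y + w)) ≡ y + (z + (x + w))
  swap-outer = solve-∀

inv-++ˡ : ∀ p {L L′} → (∀ u → rE L u ≡ rE L′ u) → inv L < inv L′ → inv (p ++ L) < inv (p ++ L′)
inv-++ˡ []      same lt = lt
inv-++ˡ (u ∷ p) {L} {L′} same lt rewrite rE-++ p L u | rE-++ p L′ u | same u =
  +-monoʳ-< (rE p u + rE L′ u) (inv-++ˡ p same lt)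

inv-exchange : ∀ {a b} → a < b → ∀ p q s → inv (p ++ a ∷ q ++ b ∷ s) < inv (p ++ b ∷ q ++ a ∷ s)
inv-exchange a<b p q s = inv-++ˡ p (rE-exchange _ _ q s) (inv-exchange-ends a<b q s)

-- Transpositions

swap-a : ∀ t → swap t (a t) ≡ b t
swap-a t rewrite ≡ᵇ-refl (a t) = refl

swap-b : ∀ t → a t ≢ b t → swap t (b t) ≡ a t
swap-b t a≢b rewrite ≡ᵇ-≢ (a≢b ∘ sym) | ≡ᵇ-refl (b t) = refl

swap-off : ∀ t {x} → x ≢ a t → x ≢ b t → swap t x ≡ x
swap-off t x≢a x≢b rewrite ≡ᵇ-≢ x≢a | ≡ᵇ-≢ x≢b = refl

data SwapView (t : Tr) : ℕ → ℕ → Set where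
  at-a : SwapView t (a t) (b t)
  at-b : a t ≢ b t → SwapView t (b t) (a t)
  off  : ∀ {x} → x ≢ a t → x ≢ b t → SwapView t x x

swapView : ∀ t x → SwapView t x (swap t x)
swapView t x with x ≟ a t | x ≟ b t
... | yes refl | _        = subst (SwapView t (a t)) (sym (swap-a t)) at-a
... | no x≢a   | yes refl = subst (SwapView t (b t)) (sym (swap-b t (x≢a ∘ sym))) (at-b (x≢a ∘ sym))
... | no x≢a   | no x≢b   = subst (SwapView t x) (sym (swap-off t x≢a x≢b)) (off x≢a x≢b)

swap-involutive : ∀ t → a t ≢ b t → ∀ x → swap t (swap t x) ≡ x
swap-involutive t a≢b x with swap t x | swapView t x
... | _ | at-a      = swap-b t a≢b
... | _ | at-b _    = swap-a t
... | _ | off p q   = swap-off t p q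

·-involutive : ∀ t → a t ≢ b t → ∀ x → t · (t · x) ≡ x
·-involutive t a≢b x = trans (sym (map-∘ x)) (trans (map-cong (swap-involutive t a≢b) x) (map-id x))

Moves : Tr → ℕ → Set
Moves t v = v ≡ a t ⊎ v ≡ b t

swap-fixed⇒¬Moves : ∀ t {v} → a t ≢ b t → swap t v ≡ v → ¬ Moves t v
swap-fixed⇒¬Moves t a≢b fixed (inj₁ refl) = a≢b (trans (sym fixed) (swap-a t))
swap-fixed⇒¬Moves t a≢b fixed (inj₂ refl) = a≢b (sym (trans (sym fixed) (swap-b t a≢b)))

swap-moves-pair : ∀ t {x y} → swap t x ≡ y → x ≢ y → (x ≡ a t × y ≡ b t) ⊎ (x ≡ b t × y ≡ a t)
swap-moves-pair t {x} eq x≢y with swap t x | swapView t x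
... | _ | at-a    = inj₁ (refl , sym eq)
... | _ | at-b _  = inj₂ (refl , sym eq)
... | _ | off _ _ = ⊥-elim (x≢y eq)

SamePair : Tr → Tr → Set
SamePair t u = (a t ≡ a u × b t ≡ b u) ⊎ (a t ≡ b u × b t ≡ a u)

SamePair⇒≡ : ∀ {t u} → a t < b t → a u < b u → SamePair t u → t ≡ u
SamePair⇒≡ _   _   (inj₁ (a≡ , b≡)) = cong₂ tr a≡ b≡
SamePair⇒≡ a<b a<b′ (inj₂ (a≡ , b≡)) =
  ⊥-elim (<-asym a<b (subst₂ _<_ (sym b≡) (sym a≡) a<b′))

product-moves : ∀ {t₁ t₂ v} → a t₁ < b t₁ → a t₂ < b t₂ → t₁ ≢ t₂ →
  Moves t₁ v ⊎ Moves t₂ v → swap t₂ (swap t₁ v) ≢ v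
product-moves {t₁} {t₂} {v} a<b₁ a<b₂ t₁≢t₂ moves fixed with swap t₁ v | swapView t₁ v
... | _ | at-a   = t₁≢t₂ (SamePair⇒≡ a<b₁ a<b₂
  (Sum.swap (Sum.map Prod.swap Prod.swap (swap-moves-pair t₂ fixed (<⇒≢ a<b₁ ∘ sym)))))
... | _ | at-b _ = t₁≢t₂ (SamePair⇒≡ a<b₁ a<b₂ (swap-moves-pair t₂ fixed (<⇒≢ a<b₁)))
... | _ | off p q with moves
...   | inj₁ (inj₁ v≡a) = p v≡a
...   | inj₁ (inj₂ v≡b) = q v≡b
...   | inj₂ moves₂     = swap-fixed⇒¬Moves t₂ (<⇒≢ a<b₂) fixed moves₂

factor-moves : ∀ t₁ t₂ v → swap t₂ (swap t₁ v) ≢ v → Moves t₁ v ⊎ Moves t₂ v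
factor-moves t₁ t₂ v moved with v ≟ a t₁ | v ≟ b t₁ | v ≟ a t₂ | v ≟ b t₂
... | yes e | _     | _     | _     = inj₁ (inj₁ e)
... | no _  | yes e | _     | _     = inj₁ (inj₂ e)
... | no _  | no _  | yes e | _     = inj₂ (inj₁ e)
... | no _  | no _  | no _  | yes e = inj₂ (inj₂ e)
... | no p  | no q  | no p′ | no q′ =
  ⊥-elim (moved (trans (cong (swap t₂) (swap-off t₁ p q)) (swap-off t₂ p′ q′)))

-- One-line notations of permutations

record PermOf (n : ℕ) (x : List ℕ) : Set where
  field
    unique   : Unique x
    complete : ∀ {v} → v < n → v ∈ x

IsPerm⇒PermOf : ∀ {n x} → IsPerm n x → PermOf n x
IsPerm⇒PermOf {n} x↭ = record
  { unique   = Unique-resp-↭ (↭⇒↭ₛ (↭-sym x↭)) (Unique.upTo⁺ n)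
  ; complete = λ v<n → ∈-resp-↭ (↭-sym x↭) (∈-upTo⁺ v<n)
  }

swap-< : ∀ {n t v} → ValidTr n t → v < n → swap t v < n
swap-< {t = t} {v} (a<b , b<n) v<n with swap t v | swapView t v
... | _ | at-a    = b<n
... | _ | at-b _  = <-trans a<b b<n
... | _ | off _ _ = v<n

PermOf-· : ∀ {n x t} → ValidTr n t → PermOf n x → PermOf n (t · x)
PermOf-· {t = t} valid@(a<b , _) x-perm = record
  { unique   = Unique.map⁺ swap-injective (PermOf.unique x-perm)
  ; complete = λ {v} v<n → subst (_∈ t · _) (swap-involutive t a≢b v)
                 (∈-map⁺ (swap t) (PermOf.complete x-perm (swap-< valid v<n)))
  }
  where
  a≢b = <⇒≢ a<b
  swap-injective : ∀ {u v} → swap t u ≡ swap t v → u ≡ v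
  swap-injective {u} {v} eq =
    trans (sym (swap-involutive t a≢b u)) (trans (cong (swap t) eq) (swap-involutive t a≢b v))

Fixes : Tr → List ℕ → Set
Fixes t = All (λ u → u ≢ a t × u ≢ b t)

·-fixes : ∀ t {L} → Fixes t L → t · L ≡ L
·-fixes t fixes = map-id-local (All.map (λ (p , q) → swap-off t p q) fixes)

data Positions (t : Tr) : List ℕ → Set where
  a-first : ∀ p q s → Fixes t p → Fixes t q → Fixes t s → Positions t (p ++ a t ∷ q ++ b t ∷ s)
  b-first : ∀ p q s → Fixes t p → Fixes t q → Fixes t s → Positions t (p ++ b t ∷ q ++ a t ∷ s)

private
  locate : ∀ {xs : List ℕ} {v} → Unique xs → v ∈ xs →
    ∃₂ λ q s → xs ≡ q ++ v ∷ s × All (_≢ v) q × All (_≢ v) s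
  locate (v∉ ∷ _)   (here refl) = [] , _ , refl , [] , All.map (_∘ sym) v∉
  locate (u∉ ∷ xs!) (there v∈) with locate xs! v∈
  ... | q , s , refl , q≢ , s≢ = _ ∷ q , s , refl , All.lookup u∉ v∈ ∷ q≢ , s≢

positions : ∀ {x t} → Unique x → a t ∈ x → b t ∈ x → a t ≢ b t → Positions t x
positions (_ ∷ _) (here refl) (here refl) a≢b = ⊥-elim (a≢b refl)
positions (a∉ ∷ xs!) (here refl) (there b∈) a≢b with locate xs! b∈
... | q , s , refl , q≢b , s≢b =
  a-first [] q s [] (All.zip (All.map (_∘ sym) (++⁻ˡ q a∉) , q≢b))
                    (All.zip (All.map (_∘ sym) (All.tail (++⁻ʳ q a∉)) , s≢b))
positions (b∉ ∷ xs!) (there a∈) (here refl) a≢b with locate xs! a∈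
... | q , s , refl , q≢a , s≢a =
  b-first [] q s [] (All.zip (q≢a , All.map (_∘ sym) (++⁻ˡ q b∉)))
                    (All.zip (s≢a , All.map (_∘ sym) (All.tail (++⁻ʳ q b∉))))
positions (u∉ ∷ xs!) (there a∈) (there b∈) a≢b with positions xs! a∈ b∈ a≢b
... | a-first p q s fp fq fs = a-first (_ ∷ p) q s ((All.lookup u∉ a∈ , All.lookup u∉ b∈) ∷ fp) fq fs
... | b-first p q s fp fq fs = b-first (_ ∷ p) q s ((All.lookup u∉ a∈ , All.lookup u∉ b∈) ∷ fp) fq fs

·-a-first : ∀ t → a t ≢ b t → ∀ {p q s} → Fixes t p → Fixes t q → Fixes t s →
  t · (p ++ a t ∷ q ++ b t ∷ s) ≡ p ++ b t ∷ q ++ a t ∷ s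
·-a-first t a≢b {p} {q} {s} fp fq fs
  rewrite map-++ (swap t) p (a t ∷ q ++ b t ∷ s) | map-++ (swap t) q (b t ∷ s)
        | ·-fixes t fp | ·-fixes t fq | ·-fixes t fs | swap-a t | swap-b t a≢b = refl

·-b-first : ∀ t → a t ≢ b t → ∀ {p q s} → Fixes t p → Fixes t q → Fixes t s →
  t · (p ++ b t ∷ q ++ a t ∷ s) ≡ p ++ a t ∷ q ++ b t ∷ s
·-b-first t a≢b {p} {q} {s} fp fq fs
  rewrite map-++ (swap t) p (b t ∷ q ++ a t ∷ s) | map-++ (swap t) q (a t ∷ s)
        | ·-fixes t fp | ·-fixes t fq | ·-fixes t fs | swap-a t | swap-b t a≢b = refl

-- Restriction to a set of values

data SameOutside (E : List ℕ) : ℕ → ℕ → Set where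
  inside  : ∀ {u v} → u ∈ E → v ∈ E → SameOutside E u v
  outside : ∀ {u} → u ∉ E → SameOutside E u u

AgreeOutside : List ℕ → List ℕ → List ℕ → Set
AgreeOutside E = Pointwise (SameOutside E)

TrIn : List ℕ → Tr → Set
TrIn E t = a t ∈ E × b t ∈ E

module _ {E : List ℕ} where

  SameOutside-refl : ∀ {u} → SameOutside E u u
  SameOutside-refl {u} with u ∈? E
  ... | yes u∈E = inside u∈E u∈E
  ... | no  u∉E = outside u∉E

  SameOutside-sym : ∀ {u v} → SameOutside E u v → SameOutside E v u
  SameOutside-sym (inside u∈E v∈E) = inside v∈E u∈E
  SameOutside-sym (outside u∉E)    = outside u∉E

  SameOutside-trans : ∀ {u v w} → SameOutside E u v → SameOutside E v w → SameOutside E u w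
  SameOutside-trans (inside u∈E _) (inside _ w∈E) = inside u∈E w∈E
  SameOutside-trans (inside _ v∈E) (outside v∉E)  = ⊥-elim (v∉E v∈E)
  SameOutside-trans (outside v∉E)  (inside v∈E _) = ⊥-elim (v∉E v∈E)
  SameOutside-trans (outside u∉E)  (outside _)    = outside u∉E

  AgreeOutside-refl : ∀ {x} → AgreeOutside E x x
  AgreeOutside-refl = Pointwise.refl SameOutside-refl

  AgreeOutside-sym : ∀ {x y} → AgreeOutside E x y → AgreeOutside E y x
  AgreeOutside-sym = Pointwise.symmetric SameOutside-sym

  AgreeOutside-trans : ∀ {x y z} → AgreeOutside E x y → AgreeOutside E y z → AgreeOutside E x z
  AgreeOutside-trans = Pointwise.transitive SameOutside-trans

  rPerm-∷-∈ : ∀ {u} w → u ∈ E → rPerm E (u ∷ w) ≡ rE E u ∷ rPerm E w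
  rPerm-∷-∈ {u} w u∈E = cong (map (rE E)) (filter-accept (T? ∘ (_∈ᵇ E)) (∈⇒∈ᵇ u∈E))

  rPerm-∷-∉ : ∀ {u} w → u ∉ E → rPerm E (u ∷ w) ≡ rPerm E w
  rPerm-∷-∉ {u} w u∉E = cong (map (rE E)) (filter-reject (T? ∘ (_∈ᵇ E)) (u∉E ∘ ∈ᵇ⇒∈ E))

  rPerm-++ : ∀ v w → rPerm E (v ++ w) ≡ rPerm E v ++ rPerm E w
  rPerm-++ v w = trans (cong (map (rE E)) (filter-++ (T? ∘ (_∈ᵇ E)) v w))
    (map-++ (rE E) (filterᵇ (_∈ᵇ E) v) (filterᵇ (_∈ᵇ E) w))

  rPerm-exchange : ∀ {u v} p q s → u ∈ E → v ∈ E →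
    rPerm E (p ++ u ∷ q ++ v ∷ s) ≡ rPerm E p ++ rE E u ∷ rPerm E q ++ rE E v ∷ rPerm E s
  rPerm-exchange {u} {v} p q s u∈E v∈E = begin
    rPerm E (p ++ u ∷ q ++ v ∷ s)           ≡⟨ rPerm-++ p _ ⟩
    rPerm E p ++ rPerm E (u ∷ q ++ v ∷ s)   ≡⟨ cong (rPerm E p ++_) (rPerm-∷-∈ _ u∈E) ⟩
    rPerm E p ++ rE E u ∷ rPerm E (q ++ v ∷ s)
      ≡⟨ cong (λ w → rPerm E p ++ rE E u ∷ w) (trans (rPerm-++ q _) (cong (rPerm E q ++_) (rPerm-∷-∈ s v∈E))) ⟩
    rPerm E p ++ rE E u ∷ rPerm E q ++ rE E v ∷ rPerm E s ∎
    where open ≡-Reasoning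

  rPerm-injective : ∀ {x y} → AgreeOutside E x y → rPerm E x ≡ rPerm E y → x ≡ y
  rPerm-injective []                         eq = refl
  rPerm-injective (inside {u} {v} u∈E v∈E ∷ x≈y) eq
    with rE≡ , rest≡ ← ∷-injective (trans (sym (rPerm-∷-∈ _ u∈E)) (trans eq (rPerm-∷-∈ _ v∈E)))
    = cong₂ _∷_ (rE-injective u∈E v∈E rE≡) (rPerm-injective x≈y rest≡)
  rPerm-injective (outside u∉E ∷ x≈y) eq =
    cong (_ ∷_) (rPerm-injective x≈y (trans (sym (rPerm-∷-∉ _ u∉E)) (trans eq (rPerm-∷-∉ _ u∉E))))

  AgreeOutside-· : ∀ {t} → TrIn E t → ∀ x → AgreeOutside E x (t · x)
  AgreeOutside-· _ [] = []
  AgreeOutside-· {t} t∈@(a∈E , b∈E) (u ∷ x) = same u ∷ AgreeOutside-· t∈ x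
    where
    same : ∀ u → SameOutside E u (swap t u)
    same u with swap t u | swapView t u
    ... | _ | at-a    = inside a∈E b∈E
    ... | _ | at-b _  = inside b∈E a∈E
    ... | _ | off _ _ = SameOutside-refl

  rTr-valid : ∀ {n t} → ValidTr n t → TrIn E t → ValidTr (length E) (rTr E t)
  rTr-valid (a<b , _) (a∈E , b∈E) = rE-strict a∈E a<b , rE-<-length b∈E

  rPerm-· : ∀ {t} → TrIn E t → a t ≢ b t → ∀ x → rPerm E (t · x) ≡ rTr E t · rPerm E x
  rPerm-· _ _ [] = refl
  rPerm-· {t} t∈@(a∈E , b∈E) a≢b (u ∷ x) with swap t u | swapView t u
  ... | _ | at-a = begin
    rPerm E (b t ∷ t · x)                   ≡⟨ rPerm-∷-∈ _ b∈E ⟩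
    rE E (b t) ∷ rPerm E (t · x)            ≡⟨ cong₂ _∷_ (sym (swap-a (rTr E t))) (rPerm-· t∈ a≢b x) ⟩
    rTr E t · (rE E (a t) ∷ rPerm E x)      ≡⟨ cong (rTr E t ·_) (rPerm-∷-∈ _ a∈E) ⟨
    rTr E t · rPerm E (a t ∷ x)             ∎
    where open ≡-Reasoning
  ... | _ | at-b _ = begin
    rPerm E (a t ∷ t · x)                   ≡⟨ rPerm-∷-∈ _ a∈E ⟩
    rE E (a t) ∷ rPerm E (t · x)
      ≡⟨ cong₂ _∷_ (sym (swap-b (rTr E t) (a≢b ∘ rE-injective a∈E b∈E))) (rPerm-· t∈ a≢b x) ⟩
    rTr E t · (rE E (b t) ∷ rPerm E x)      ≡⟨ cong (rTr E t ·_) (rPerm-∷-∈ _ b∈E) ⟨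
    rTr E t · rPerm E (b t ∷ x)             ∎
    where open ≡-Reasoning
  ... | _ | off u≢a u≢b with u ∈? E
  ...   | no u∉E = begin
    rPerm E (u ∷ t · x)                     ≡⟨ rPerm-∷-∉ _ u∉E ⟩
    rPerm E (t · x)                         ≡⟨ rPerm-· t∈ a≢b x ⟩
    rTr E t · rPerm E x                     ≡⟨ cong (rTr E t ·_) (rPerm-∷-∉ _ u∉E) ⟨
    rTr E t · rPerm E (u ∷ x)               ∎
    where open ≡-Reasoning
  ...   | yes u∈E = begin
    rPerm E (u ∷ t · x)                     ≡⟨ rPerm-∷-∈ _ u∈E ⟩
    rE E u ∷ rPerm E (t · x)
      ≡⟨ cong₂ _∷_ (sym (swap-off (rTr E t) (u≢a ∘ rE-injective u∈E a∈E) (u≢b ∘ rE-injective u∈E b∈E)))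
                   (rPerm-· t∈ a≢b x) ⟩
    rTr E t · (rE E u ∷ rPerm E x)          ≡⟨ cong (rTr E t ·_) (rPerm-∷-∈ _ u∈E) ⟨
    rTr E t · rPerm E (u ∷ x)               ∎
    where open ≡-Reasoning

  TrIn-product : ∀ {n X t₁ t₂ t₁′ t₂′} → PermOf n X → TrIn E t₁ → TrIn E t₂ →
    ValidTr n t₁′ → ValidTr n t₂′ → t₁′ ≢ t₂′ → t₂ · (t₁ · X) ≡ t₂′ · (t₁′ · X) → TrIn E t₁′ × TrIn E t₂′
  TrIn-product {X = X} {t₁} {t₂} {t₁′} {t₂′} X-perm (a₁∈ , b₁∈) (a₂∈ , b₂∈)
               (a<b₁′ , b<n₁′) (a<b₂′ , b<n₂′) t₁′≢t₂′ same =
    (in-E (<-trans a<b₁′ b<n₁′) (inj₁ (inj₁ refl)) , in-E b<n₁′ (inj₁ (inj₂ refl))) ,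
    (in-E (<-trans a<b₂′ b<n₂′) (inj₂ (inj₁ refl)) , in-E b<n₂′ (inj₂ (inj₂ refl)))
    where
    moved-in-E : ∀ {v} → Moves t₁ v ⊎ Moves t₂ v → v ∈ E
    moved-in-E (inj₁ (inj₁ refl)) = a₁∈
    moved-in-E (inj₁ (inj₂ refl)) = b₁∈
    moved-in-E (inj₂ (inj₁ refl)) = a₂∈
    moved-in-E (inj₂ (inj₂ refl)) = b₂∈
    in-E : ∀ {v} → v < _ → Moves t₁′ v ⊎ Moves t₂′ v → v ∈ E
    in-E {v} v<n moves′ = moved-in-E (factor-moves t₁ t₂ v λ fixed →
      product-moves a<b₁′ a<b₂′ t₁′≢t₂′ moves′ (trans (sym same-at-v) fixed))
      where
      same-at-v : swap t₂ (swap t₁ v) ≡ swap t₂′ (swap t₁′ v)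
      same-at-v = map-≡⇒≡ (trans (map-∘ X) (trans same (sym (map-∘ X)))) (PermOf.complete X-perm v<n)

  inv-rPerm-· : ∀ {n x t} → PermOf n x → ValidTr n t → TrIn E t →
    (inv x < inv (t · x)) ⇔ (inv (rPerm E x) < inv (rPerm E (t · x)))
  inv-rPerm-· {x = x} {t} x-perm (a<b , b<n) (a∈E , b∈E)
    with positions (PermOf.unique x-perm) (PermOf.complete x-perm (<-trans a<b b<n))
                   (PermOf.complete x-perm b<n) (<⇒≢ a<b)
  ... | a-first p q s fp fq fs
    rewrite ·-a-first t (<⇒≢ a<b) fp fq fs | rPerm-exchange p q s a∈E b∈E | rPerm-exchange p q s b∈E a∈E
    = mk⇔ (λ _ → inv-exchange (rE-strict a∈E a<b) (rPerm E p) (rPerm E q) (rPerm E s))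
          (λ _ → inv-exchange a<b p q s)
  ... | b-first p q s fp fq fs
    rewrite ·-b-first t (<⇒≢ a<b) fp fq fs | rPerm-exchange p q s a∈E b∈E | rPerm-exchange p q s b∈E a∈E
    = mk⇔ (λ lt → ⊥-elim (<-asym lt (inv-exchange a<b p q s)))
          (λ lt → ⊥-elim (<-asym lt (inv-exchange (rE-strict a∈E a<b) (rPerm E p) (rPerm E q) (rPerm E s))))

-- Strictly increasing lists

nth-∈ : ∀ L {k} → k < length L → nth L k ∈ L
nth-∈ (u ∷ L) {zero}  _         = here refl
nth-∈ (u ∷ L) {suc k} (s<s k<l) = there (nth-∈ L k<l)

rE-≤-all : ∀ {x} L → All (x ≤_) L → rE L x ≡ 0
rE-≤-all {x} L x≤L =
  cong length (filter-none (T? ∘ (_<ᵇ x)) (All.map (λ {y} x≤y y<x → ≤⇒≯ x≤y (<ᵇ⇒< y x y<x)) x≤L))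

rE-head : ∀ {x L} → All (x <_) L → rE (x ∷ L) x ≡ 0
rE-head {x} {L} x<L = rE-≤-all (x ∷ L) (≤-refl ∷ All.map <⇒≤ x<L)

nth-rE : ∀ {L x} → AllPairs _<_ L → x ∈ L → nth L (rE L x) ≡ x
nth-rE (x<L ∷ _) (here refl) rewrite rE-head x<L = refl
nth-rE {u ∷ L} (u<L ∷ L<) (there x∈L) rewrite rE-∷-< L (All.lookup u<L x∈L) = nth-rE L< x∈L

rE-nth : ∀ {L k} → AllPairs _<_ L → k < length L → rE L (nth L k) ≡ k
rE-nth {u ∷ L} {zero}  (u<L ∷ _)  _         = rE-head u<L
rE-nth {u ∷ L} {suc k} (u<L ∷ L<) (s<s k<l) =
  trans (rE-∷-< L (All.lookup u<L (nth-∈ L k<l))) (cong suc (rE-nth L< k<l))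

map-rE : ∀ {L} → AllPairs _<_ L → map (rE L) L ≡ upTo (length L)
map-rE []                     = refl
map-rE {u ∷ L} (u<L ∷ L<) = cong₂ _∷_ (rE-head u<L) (begin
  map (rE (u ∷ L)) L     ≡⟨ map-cong-local (All.map (rE-∷-< L) u<L) ⟩
  map (suc ∘ rE L) L     ≡⟨ map-∘ L ⟩
  map suc (map (rE L) L) ≡⟨ cong (map suc) (map-rE L<) ⟩
  map suc (upTo (length L)) ≡⟨ map-upTo suc (length L) ⟩
  applyUpTo suc (length L) ∎)
  where open ≡-Reasoning

nth-strict : ∀ {L i j} → AllPairs _<_ L → i < j → j < length L → nth L i < nth L j
nth-strict {L} {i} {j} L< i<j j<l with nth L i <? nth L j
... | yes lt = lt
... | no ≮  = ⊥-elim (<⇒≱ i<j (subst₂ _≤_ (rE-nth L< j<l) (rE-nth L< (<-trans i<j j<l)) (rE-mono L (≮⇒≥ ≮))))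

-- Paths

vertex : ∀ {h} → Path h → Fin (suc h) → List ℕ
vertex Γ = lookup (vs Γ)

label : ∀ {h} → Path h → Fin h → Tr
label Γ = lookup (ls Γ)

head≡vertex-zero : ∀ {h} (Γ : Path h) → Vec.head (vs Γ) ≡ vertex Γ zero
head≡vertex-zero (path (x ∷ _) _) = refl

Path-ext : ∀ {h} {Γ Δ : Path h} → (∀ k → vertex Γ k ≡ vertex Δ k) → (∀ i → label Γ i ≡ label Δ i) → Γ ≡ Δ
Path-ext {Γ = path xs ts} {path ys us} xs≗ys ts≗us = cong₂ path (Vec-ext xs≗ys) (Vec-ext ts≗us)
  where
  Vec-ext : ∀ {A : Set} {k} {u w : Vec A k} → lookup u ≗ lookup w → u ≡ w
  Vec-ext {u = u} {w} u≗w = trans (sym (tabulate∘lookup u)) (trans (tabulate-cong u≗w) (tabulate∘lookup w))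

vertex-mapPath : ∀ {h} f g (Γ : Path h) k → vertex (mapPath f g Γ) k ≡ f (vertex Γ k)
vertex-mapPath f g Γ k = lookup-map k f (vs Γ)

label-mapPath : ∀ {h} f g (Γ : Path h) i → label (mapPath f g Γ) i ≡ g (label Γ i)
label-mapPath f g Γ i = lookup-map i g (ls Γ)

walkFrom : ∀ {h} → List ℕ → Vec Tr h → Vec (List ℕ) (suc h)
walkFrom x []       = x ∷ []
walkFrom x (t ∷ ts) = x ∷ walkFrom (t · x) ts

walkFrom-zero : ∀ {h} x (ts : Vec Tr h) → lookup (walkFrom x ts) zero ≡ x
walkFrom-zero x []       = refl
walkFrom-zero x (t ∷ ts) = refl

walkFrom-suc : ∀ {h} x (ts : Vec Tr h) i →
  lookup (walkFrom x ts) (suc i) ≡ lookup ts i · lookup (walkFrom x ts) (inject₁ i)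
walkFrom-suc x (t ∷ ts) zero    = walkFrom-zero (t · x) ts
walkFrom-suc x (t ∷ ts) (suc i) = walkFrom-suc (t · x) ts i

record Corner (h j : ℕ) : Set where
  field
    before after : Fin h
    toℕ-before   : suc (toℕ before) ≡ j
    toℕ-after    : toℕ after ≡ j
    consecutive  : Fin.suc before ≡ inject₁ after

corner : ∀ {h j} → 1 ≤ j → j < h → Corner h j
corner {h} {suc j} (s≤s z≤n) j<h = record
  { before      = fromℕ< j<h′
  ; after       = fromℕ< j<h
  ; toℕ-before  = cong suc (toℕ-fromℕ< j<h′)
  ; toℕ-after   = toℕ-fromℕ< j<h
  ; consecutive = toℕ-injective (trans (cong suc (toℕ-fromℕ< j<h′))
                                       (sym (trans (toℕ-inject₁ (fromℕ< j<h)) (toℕ-fromℕ< j<h))))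
  }
  where j<h′ = <-trans (n<1+n j) j<h

module _ {n h} {Γ : Path h} (Γ-path : IsPath n Γ) {i i′ : Fin h} (i→i′ : Fin.suc i ≡ inject₁ i′) where

  two-steps : vertex Γ (suc i′) ≡ label Γ i′ · (label Γ i · vertex Γ (inject₁ i))
  two-steps = trans (proj₁ (proj₂ (proj₂ Γ-path i′ )))
    (cong (label Γ i′ ·_) (trans (cong (vertex Γ) (sym i→i′)) (proj₁ (proj₂ (proj₂ Γ-path i)))))

  consecutive-labels-≢ : label Γ i ≢ label Γ i′
  consecutive-labels-≢ t≡t′ = <-irrefl (cong inv (sym returns)) (<-trans inv-first inv-second)
    where
    inv-first : inv (vertex Γ (inject₁ i)) < inv (vertex Γ (inject₁ i′))
    inv-first = subst (λ k → inv (vertex Γ (inject₁ i)) < inv (vertex Γ k)) i→i′ (proj₂ (proj₂ (proj₂ Γ-path i)))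
    inv-second : inv (vertex Γ (inject₁ i′)) < inv (vertex Γ (suc i′))
    inv-second = proj₂ (proj₂ (proj₂ Γ-path i′))
    returns : vertex Γ (suc i′) ≡ vertex Γ (inject₁ i)
    returns = trans two-steps (trans (cong (λ t → t · (label Γ i · _)) (sym t≡t′))
                (·-involutive (label Γ i) (<⇒≢ (proj₁ (proj₁ (proj₂ Γ-path i)))) _))

module StarSimulation {A B : Set} {R : A → A → Set} {S : B → B → Set} (P : A → Set) (φ : A → B)
  (P-step : ∀ a a′ → P a → R a a′ → P a′)
  (forth  : ∀ a a′ → P a → R a a′ → S (φ a) (φ a′))
  (back   : ∀ a b′ → P a → S (φ a) b′ → ∃ λ a′ → R a a′ × φ a′ ≡ b′) where

  Star-P : ∀ {a a′} → P a → Star R a a′ → P a′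
  Star-P pa ε        = pa
  Star-P pa (r ◅ rs) = Star-P (P-step _ _ pa r) rs

  Star-forth : ∀ {a a′} → P a → Star R a a′ → Star S (φ a) (φ a′)
  Star-forth pa ε        = ε
  Star-forth pa (r ◅ rs) = forth _ _ pa r ◅ Star-forth (P-step _ _ pa r) rs

  Star-back : ∀ {a b} → P a → Star S (φ a) b → ∃ λ a′ → Star R a a′ × φ a′ ≡ b
  Star-back pa ε = _ , ε , refl
  Star-back pa (s ◅ ss) with back _ _ pa s
  ... | a′ , r , refl with Star-back (P-step _ _ pa r) ss
  ...   | a″ , rs , eq = a″ , r ◅ rs , eq

  Star-image⇔ : ∀ {a} → P a → ∀ b → (∃ λ a′ → Star R a a′ × φ a′ ≡ b) ⇔ Star S (φ a) b
  Star-image⇔ pa b = mk⇔ (λ { (a′ , rs , refl) → Star-forth pa rs }) (Star-back pa)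

module PathImage {h} (f : List ℕ → List ℕ) (g : Tr → Tr) (F : Path h → Set) where

  F′ : Path h → Set
  F′ = Image (mapPath f g) F

  f₂ : List ℕ × ℕ → List ℕ × ℕ
  f₂ (x , i) = f x , i

  private
    f-vertex : ∀ (Γ : Path h) k → vertex (mapPath f g Γ) k ≡ f (vertex Γ k)
    f-vertex = vertex-mapPath f g
    g-label : ∀ (Γ : Path h) i → label (mapPath f g Γ) i ≡ g (label Γ i)
    g-label = label-mapPath f g

  VS-image⇔ : ∀ x′ → VS F′ x′ ⇔ (∃ λ x → VS F x × f x ≡ x′)
  VS-image⇔ x′ = mk⇔
    (λ { (_ , (Γ , Γ∈F , refl) , k , eq) → vertex Γ k , (Γ , Γ∈F , k , refl) , trans (sym (f-vertex Γ k)) eq })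
    (λ { (x , (Γ , Γ∈F , k , refl) , refl) → mapPath f g Γ , (Γ , Γ∈F , refl) , k , f-vertex Γ k })

  LS-image⇔ : ∀ t′ → LS F′ t′ ⇔ (∃ λ t → LS F t × g t ≡ t′)
  LS-image⇔ t′ = mk⇔
    (λ { (_ , (Γ , Γ∈F , refl) , i , eq) → label Γ i , (Γ , Γ∈F , i , refl) , trans (sym (g-label Γ i)) eq })
    (λ { (t , (Γ , Γ∈F , i , refl) , refl) → mapPath f g Γ , (Γ , Γ∈F , refl) , i , g-label Γ i })

  TVS-image⇔ : ∀ p′ → TVS F′ p′ ⇔ (∃ λ p → TVS F p × f₂ p ≡ p′)
  TVS-image⇔ (x′ , i) = mk⇔
    (λ { (_ , (Γ , Γ∈F , refl) , k , k≡i , eq) →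
           (vertex Γ k , i) , (Γ , Γ∈F , k , k≡i , refl) , cong (_, i) (trans (sym (f-vertex Γ k)) eq) })
    (λ { ((x , .i) , (Γ , Γ∈F , k , k≡i , refl) , refl) →
           mapPath f g Γ , (Γ , Γ∈F , refl) , k , k≡i , f-vertex Γ k })

  TVS⇒VS : ∀ {x i} → TVS F (x , i) → VS F x
  TVS⇒VS (Γ , Γ∈F , k , _ , x≡) = Γ , Γ∈F , k , x≡

  ES-image : ∀ x t y → ES F x t y → ES F′ (f x) (g t) (f y)
  ES-image _ _ _ (Γ , Γ∈F , i , refl , refl , refl) =
    mapPath f g Γ , (Γ , Γ∈F , refl) , i , f-vertex Γ (inject₁ i) , g-label Γ i , f-vertex Γ (suc i)

  TES-image : ∀ p t q → TES F p t q → TES F′ (f₂ p) (g t) (f₂ q)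
  TES-image _ _ _ (refl , Γ , Γ∈F , k , k≡i , refl , refl , refl) =
    refl , mapPath f g Γ , (Γ , Γ∈F , refl) , k , k≡i , f-vertex Γ (inject₁ k) , g-label Γ k , f-vertex Γ (suc k)

  Walk-ES-labels : ∀ x st → Walk (ES F) x st → All (LS F) (map proj₁ st)
  Walk-ES-labels x []            _ = []
  Walk-ES-labels x ((t , y) ∷ st) ((Γ , Γ∈F , i , _ , t≡ , _) , walk) =
    (Γ , Γ∈F , i , t≡) ∷ Walk-ES-labels y st walk

  Walk-TES-labels : ∀ p st → Walk (TES F) p st → All (LS F) (map proj₁ st)
  Walk-TES-labels p []            _ = []
  Walk-TES-labels p ((t , q) ∷ st) ((_ , Γ , Γ∈F , k , _ , _ , t≡ , _) , walk) =
    (Γ , Γ∈F , k , t≡) ∷ Walk-TES-labels q st walk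

  module _ (f-injective : ∀ x y → VS F x → VS F y → f x ≡ f y → x ≡ y) where

    f₂-injective : ∀ p q → TVS F p → TVS F q → f₂ p ≡ f₂ q → p ≡ q
    f₂-injective (x , _) (y , _) p∈ q∈ eq =
      cong₂ _,_ (f-injective x y (TVS⇒VS p∈) (TVS⇒VS q∈) (cong proj₁ eq)) (cong proj₂ eq)

    ES-image⁻ : ∀ x t′ y → VS F x → VS F y → ES F′ (f x) t′ (f y) → ∃ λ t → ES F x t y × g t ≡ t′
    ES-image⁻ x _ y x∈ y∈ (_ , (Γ , Γ∈F , refl) , i , x≡ , refl , y≡) =
      label Γ i ,
      (Γ , Γ∈F , i ,
        f-injective _ x (Γ , Γ∈F , inject₁ i , refl) x∈ (trans (sym (f-vertex Γ (inject₁ i))) x≡) ,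
        refl ,
        f-injective _ y (Γ , Γ∈F , suc i , refl) y∈ (trans (sym (f-vertex Γ (suc i))) y≡)) ,
      sym (g-label Γ i)

    TES-image⁻ : ∀ p t′ q → TVS F p → TVS F q → TES F′ (f₂ p) t′ (f₂ q) → ∃ λ t → TES F p t q × g t ≡ t′
    TES-image⁻ (x , i) _ (y , j) p∈ q∈ (j≡ , _ , (Γ , Γ∈F , refl) , k , k≡i , x≡ , refl , y≡) =
      label Γ k ,
      (j≡ , Γ , Γ∈F , k , k≡i ,
        f-injective _ x (Γ , Γ∈F , inject₁ k , refl) (TVS⇒VS p∈) (trans (sym (f-vertex Γ (inject₁ k))) x≡) ,
        refl ,
        f-injective _ y (Γ , Γ∈F , suc k , refl) (TVS⇒VS q∈) (trans (sym (f-vertex Γ (suc k))) y≡)) ,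
      sym (g-label Γ k)

Increasing-map⇔ : ∀ {P : Tr → Set} {R R′ : Tr → Tr → Set} (g : Tr → Tr) →
  (∀ {t u} → P t → P u → R t u ⇔ R′ (g t) (g u)) → ∀ {ts} → All P ts → Increasing R ts ⇔ Increasing R′ (map g ts)
Increasing-map⇔ g R⇔R′ []                 = mk⇔ _ _
Increasing-map⇔ g R⇔R′ (_ ∷ [])           = mk⇔ _ _
Increasing-map⇔ g R⇔R′ (pt ∷ pu ∷ pts)    = R⇔R′ pt pu ×-⇔ Increasing-map⇔ g R⇔R′ (pu ∷ pts)

-- Restriction to a subset of [n]

module Restriction (n : ℕ) (p : ℕ → Bool) where

  E : List ℕ
  E = filterᵇ p (upTo n)

  m : ℕ
  m = length E

  E-sorted : AllPairs _<_ E
  E-sorted = AllPairs.filter⁺ (T? ∘ p) (AllPairs.applyUpTo⁺₁ id n (λ i<j _ → i<j))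

  ∈E⇒< : ∀ {x} → x ∈ E → x < n
  ∈E⇒< x∈E = ∈-upTo⁻ (proj₁ (∈-filter⁻ (T? ∘ p) {xs = upTo n} x∈E))

  filterᵇ-∈E-upTo : filterᵇ (_∈ᵇ E) (upTo n) ≡ E
  filterᵇ-∈E-upTo = filterᵇ-cong-local (_∈ᵇ E) p {upTo n} (All.tabulate λ x∈ → mk⇔
    (λ x∈ᵇE → proj₂ (∈-filter⁻ (T? ∘ p) {xs = upTo n} (∈ᵇ⇒∈ E x∈ᵇE)))
    (λ px → ∈⇒∈ᵇ (∈-filter⁺ (T? ∘ p) x∈ px)))

  IsPerm-rPerm : ∀ {x} → IsPerm n x → IsPerm m (rPerm E x)
  IsPerm-rPerm {x} x↭ = begin
    map (rE E) (filterᵇ (_∈ᵇ E) x)        ↭⟨ map⁺ (rE E) (filter-↭ (T? ∘ (_∈ᵇ E)) x↭) ⟩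
    map (rE E) (filterᵇ (_∈ᵇ E) (upTo n)) ≡⟨ cong (map (rE E)) filterᵇ-∈E-upTo ⟩
    map (rE E) E                          ≡⟨ map-rE E-sorted ⟩
    upTo m                                ∎
    where open PermutationReasoning

  liftTr : Tr → Tr
  liftTr t = tr (nth E (a t)) (nth E (b t))

  liftTr-rTr : ∀ {t} → TrIn E t → liftTr (rTr E t) ≡ t
  liftTr-rTr (a∈E , b∈E) = cong₂ tr (nth-rE E-sorted a∈E) (nth-rE E-sorted b∈E)

  rTr-liftTr : ∀ {t} → ValidTr m t → rTr E (liftTr t) ≡ t
  rTr-liftTr (a<b , b<m) = cong₂ tr (rE-nth E-sorted (<-trans a<b b<m)) (rE-nth E-sorted b<m)

  liftTr-in : ∀ {t} → ValidTr m t → TrIn E (liftTr t)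
  liftTr-in (a<b , b<m) = nth-∈ E (<-trans a<b b<m) , nth-∈ E b<m

  liftTr-valid : ∀ {t} → ValidTr m t → ValidTr n (liftTr t)
  liftTr-valid (a<b , b<m) = nth-strict E-sorted a<b b<m , ∈E⇒< (nth-∈ E b<m)

  rTr-injective : ∀ {t u} → TrIn E t → TrIn E u → rTr E t ≡ rTr E u → t ≡ u
  rTr-injective t∈ u∈ eq = trans (sym (liftTr-rTr t∈)) (trans (cong liftTr eq) (liftTr-rTr u∈))

  rTr-LexLe : ∀ {t u} → TrIn E t → TrIn E u → LexLe t u → LexLe (rTr E t) (rTr E u)
  rTr-LexLe (a∈E , _) _ (inj₁ a<a′)       = inj₁ (rE-strict a∈E a<a′)
  rTr-LexLe _        _ (inj₂ (a≡a′ , b≤b′)) = inj₂ (cong (rE E) a≡a′ , rE-mono E b≤b′)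

  rPath-vertex : ∀ {h} (Θ : Path h) k → vertex (rPath E Θ) k ≡ rPerm E (vertex Θ k)
  rPath-vertex = vertex-mapPath (rPerm E) (rTr E)

  rPath-label : ∀ {h} (Θ : Path h) i → label (rPath E Θ) i ≡ rTr E (label Θ i)
  rPath-label = label-mapPath (rPerm E) (rTr E)

  module From (x₀ : List ℕ) (x₀-perm : IsPerm n x₀) where

    Reachable : List ℕ → Set
    Reachable x = PermOf n x × AgreeOutside E x₀ x

    x₀-reachable : Reachable x₀
    x₀-reachable = IsPerm⇒PermOf x₀-perm , AgreeOutside-refl

    Reachable-· : ∀ {t x} → ValidTr n t → TrIn E t → Reachable x → Reachable (t · x)
    Reachable-· {x = x} valid t∈ (x-perm , x₀≈x) =
      PermOf-· valid x-perm , AgreeOutside-trans x₀≈x (AgreeOutside-· t∈ x)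

    rPerm-injective-on : ∀ {x y} → Reachable x → Reachable y → rPerm E x ≡ rPerm E y → x ≡ y
    rPerm-injective-on (_ , x₀≈x) (_ , x₀≈y) = rPerm-injective (AgreeOutside-trans (AgreeOutside-sym x₀≈x) x₀≈y)

    Edge-rPerm : ∀ {x t y} → Reachable x → TrIn E t → Edge n x t y → Edge m (rPerm E x) (rTr E t) (rPerm E y)
    Edge-rPerm {x} (x-perm , _) t∈ (valid , refl , inv<) =
      rTr-valid valid t∈ , rPerm-· t∈ (<⇒≢ (proj₁ valid)) x , to (inv-rPerm-· x-perm valid t∈) inv<

    record Supported {h} (Γ : Path h) : Set where
      field
        isPath    : IsPath n Γ
        starts    : vertex Γ zero ≡ x₀
        labels-in : ∀ i → TrIn E (label Γ i)

    open Supported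

    Supported-reachable : ∀ {h} {Γ : Path h} → Supported Γ → ∀ k → Reachable (vertex Γ k)
    Supported-reachable {Γ = Γ} sΓ = <-weakInduction (Reachable ∘ vertex Γ)
      (subst Reachable (sym (starts sΓ)) x₀-reachable)
      (λ i reachable → let (valid , next , _) = proj₂ (isPath sΓ) i in
        subst Reachable (sym next) (Reachable-· valid (labels-in sΓ i) reachable))

    rPath-IsPath : ∀ {h} {Γ : Path h} → Supported Γ → IsPath m (rPath E Γ)
    rPath-IsPath {Γ = Γ} sΓ = subst (_↭ upTo m) (sym r-head) (IsPerm-rPerm x₀-perm) , r-edge
      where
      r-head : Vec.head (vs (rPath E Γ)) ≡ rPerm E x₀
      r-head = trans (head≡vertex-zero (rPath E Γ)) (trans (rPath-vertex Γ zero) (cong (rPerm E) (starts sΓ)))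
      r-edge : ∀ i → Edge m (vertex (rPath E Γ) (inject₁ i)) (label (rPath E Γ) i) (vertex (rPath E Γ) (suc i))
      r-edge i rewrite rPath-vertex Γ (inject₁ i) | rPath-label Γ i | rPath-vertex Γ (suc i)
        = Edge-rPerm (Supported-reachable sΓ (inject₁ i)) (labels-in sΓ i) (proj₂ (isPath sΓ) i)

    Supported-flip : ∀ {h} {Γ Γ′ : Path h} {j} → Supported Γ → FlipAt n Γ Γ′ j → Supported Γ′
    Supported-flip {Γ = Γ} {Γ′} {j} sΓ (1≤j , j<h , _ , Γ′-path , same-vertex , same-label , _) = record
      { isPath    = Γ′-path
      ; starts    = trans (same-vertex zero (<⇒≢ 1≤j)) (starts sΓ)
      ; labels-in = labels-in′
      }
      where
      open Corner (corner 1≤j j<h)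
      X-same : vertex Γ′ (inject₁ before) ≡ vertex Γ (inject₁ before)
      X-same = same-vertex (inject₁ before) λ eq → 1+n≢n (trans toℕ-before (trans (sym eq) (toℕ-inject₁ before)))
      Y-same : vertex Γ′ (suc after) ≡ vertex Γ (suc after)
      Y-same = same-vertex (suc after) λ eq → 1+n≢n (trans eq (sym toℕ-after))
      corner-labels : TrIn E (label Γ′ before) × TrIn E (label Γ′ after)
      corner-labels = TrIn-product (proj₁ (Supported-reachable sΓ (inject₁ before)))
        (labels-in sΓ before) (labels-in sΓ after)
        (proj₁ (proj₂ Γ′-path before)) (proj₁ (proj₂ Γ′-path after))
        (consecutive-labels-≢ {Γ = Γ′} Γ′-path consecutive)
        (trans (sym (two-steps {Γ = Γ} (isPath sΓ) consecutive))
          (trans (sym Y-same) (trans (two-steps {Γ = Γ′} Γ′-path consecutive)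
            (cong (λ X → label Γ′ after · (label Γ′ before · X)) X-same))))
      labels-in′ : ∀ k → TrIn E (label Γ′ k)
      labels-in′ k with toℕ k ≟ j | suc (toℕ k) ≟ j
      ... | no k≢j  | no k+1≢j = subst (TrIn E) (sym (same-label k k≢j k+1≢j)) (labels-in sΓ k)
      ... | yes k≡j | _        =
        subst (TrIn E ∘ label Γ′) (toℕ-injective (trans toℕ-after (sym k≡j))) (proj₂ corner-labels)
      ... | no _    | yes k+1≡j =
        subst (TrIn E ∘ label Γ′) (toℕ-injective (suc-injective (trans toℕ-before (sym k+1≡j))))
          (proj₁ corner-labels)

    rPath-injective : ∀ {h} {Γ Δ : Path h} → Supported Γ → Supported Δ → rPath E Γ ≡ rPath E Δ → Γ ≡ Δ
    rPath-injective {Γ = Γ} {Δ} sΓ sΔ eq = Path-ext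
      (λ k → rPerm-injective-on (Supported-reachable sΓ k) (Supported-reachable sΔ k)
        (trans (sym (rPath-vertex Γ k)) (trans (cong (λ Θ → vertex Θ k) eq) (rPath-vertex Δ k))))
      (λ i → rTr-injective (labels-in sΓ i) (labels-in sΔ i)
        (trans (sym (rPath-label Γ i)) (trans (cong (λ Θ → label Θ i) eq) (rPath-label Δ i))))

    FlipAt-rPath⇔ : ∀ {h} {Γ Γ′ : Path h} {j} → Supported Γ → Supported Γ′ →
      FlipAt n Γ Γ′ j ⇔ FlipAt m (rPath E Γ) (rPath E Γ′) j
    FlipAt-rPath⇔ {Γ = Γ} {Γ′} sΓ sΓ′ = mk⇔
      (λ (1≤j , j<h , _ , _ , same-vertex , same-label , k , k≡j , moved) →
        1≤j , j<h , rPath-IsPath sΓ , rPath-IsPath sΓ′ ,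
        (λ k k≢j → trans (rPath-vertex Γ′ k)
                     (trans (cong (rPerm E) (same-vertex k k≢j)) (sym (rPath-vertex Γ k)))) ,
        (λ k k≢j k+1≢j → trans (rPath-label Γ′ k)
                           (trans (cong (rTr E) (same-label k k≢j k+1≢j)) (sym (rPath-label Γ k)))) ,
        k , k≡j , λ eq → moved (rPerm-injective-on (Supported-reachable sΓ′ k) (Supported-reachable sΓ k)
                                  (trans (sym (rPath-vertex Γ′ k)) (trans eq (rPath-vertex Γ k)))))
      (λ (1≤j , j<h , _ , _ , same-vertex , same-label , k , k≡j , moved) →
        1≤j , j<h , isPath sΓ , isPath sΓ′ ,
        (λ k k≢j → rPerm-injective-on (Supported-reachable sΓ′ k) (Supported-reachable sΓ k)
                     (trans (sym (rPath-vertex Γ′ k)) (trans (same-vertex k k≢j) (rPath-vertex Γ k)))) ,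
        (λ k k≢j k+1≢j → rTr-injective (labels-in sΓ′ k) (labels-in sΓ k)
                     (trans (sym (rPath-label Γ′ k)) (trans (same-label k k≢j k+1≢j) (rPath-label Γ k)))) ,
        k , k≡j , λ eq → moved (trans (rPath-vertex Γ′ k) (trans (cong (rPerm E) eq) (sym (rPath-vertex Γ k)))))

    lift : ∀ {h} → Path h → Path h
    lift Δ = path (walkFrom x₀ (Vec.map liftTr (ls Δ))) (Vec.map liftTr (ls Δ))

    module _ {h} (Δ : Path h) (Δ-path : IsPath m Δ) (Δ-starts : vertex Δ zero ≡ rPerm E x₀) where

      private
        lifted : Fin h → Tr
        lifted i = liftTr (label Δ i)

        Δ-valid : ∀ i → ValidTr m (label Δ i)
        Δ-valid i = proj₁ (proj₂ Δ-path i)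

        lifted-valid : ∀ i → ValidTr n (lifted i)
        lifted-valid i = liftTr-valid (Δ-valid i)

        lifted-in : ∀ i → TrIn E (lifted i)
        lifted-in i = liftTr-in (Δ-valid i)

        lift-label : ∀ i → label (lift Δ) i ≡ lifted i
        lift-label i = lookup-map i liftTr (ls Δ)

        lift-zero : vertex (lift Δ) zero ≡ x₀
        lift-zero = walkFrom-zero x₀ (Vec.map liftTr (ls Δ))

        lift-suc : ∀ i → vertex (lift Δ) (suc i) ≡ lifted i · vertex (lift Δ) (inject₁ i)
        lift-suc i = trans (walkFrom-suc x₀ (Vec.map liftTr (ls Δ)) i)
                           (cong (_· vertex (lift Δ) (inject₁ i)) (lift-label i))

      lift-reachable : ∀ k → Reachable (vertex (lift Δ) k)
      lift-reachable = <-weakInduction (Reachable ∘ vertex (lift Δ))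
        (subst Reachable (sym lift-zero) x₀-reachable)
        (λ i reachable → subst Reachable (sym (lift-suc i)) (Reachable-· (lifted-valid i) (lifted-in i) reachable))

      rPerm-lift : ∀ k → rPerm E (vertex (lift Δ) k) ≡ vertex Δ k
      rPerm-lift = <-weakInduction (λ k → rPerm E (vertex (lift Δ) k) ≡ vertex Δ k)
        (trans (cong (rPerm E) lift-zero) (sym Δ-starts))
        λ i r≡ → begin
          rPerm E (vertex (lift Δ) (suc i))                        ≡⟨ cong (rPerm E) (lift-suc i) ⟩
          rPerm E (lifted i · vertex (lift Δ) (inject₁ i))
            ≡⟨ rPerm-· (lifted-in i) (<⇒≢ (proj₁ (lifted-valid i))) (vertex (lift Δ) (inject₁ i)) ⟩
          rTr E (lifted i) · rPerm E (vertex (lift Δ) (inject₁ i)) ≡⟨ cong₂ _·_ (rTr-liftTr (Δ-valid i)) r≡ ⟩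
          label Δ i · vertex Δ (inject₁ i)                         ≡⟨ proj₁ (proj₂ (proj₂ Δ-path i)) ⟨
          vertex Δ (suc i)                                         ∎
        where open ≡-Reasoning

      lift-supported : Supported (lift Δ)
      lift-supported = record
        { isPath    = subst (_↭ upTo n) (sym (trans (head≡vertex-zero (lift Δ)) lift-zero)) x₀-perm , lift-edge
        ; starts    = lift-zero
        ; labels-in = λ i → subst (TrIn E) (sym (lift-label i)) (lifted-in i)
        }
        where
        lift-edge : ∀ i → Edge n (vertex (lift Δ) (inject₁ i)) (label (lift Δ) i) (vertex (lift Δ) (suc i))
        lift-edge i rewrite lift-label i | lift-suc i =
          lifted-valid i , refl ,
          from (inv-rPerm-· (proj₁ (lift-reachable (inject₁ i))) (lifted-valid i) (lifted-in i))
            (subst₂ (λ x y → inv x < inv y) (sym (rPerm-lift (inject₁ i)))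
               (trans (sym (rPerm-lift (suc i))) (cong (rPerm E) (lift-suc i)))
               (proj₂ (proj₂ (proj₂ Δ-path i))))

      rPath-lift : rPath E (lift Δ) ≡ Δ
      rPath-lift = Path-ext (λ k → trans (rPath-vertex (lift Δ) k) (rPerm-lift k))
        (λ i → trans (rPath-label (lift Δ) i) (trans (cong (rTr E) (lift-label i)) (rTr-liftTr (Δ-valid i))))

    FlipAt-lift : ∀ {h} {Γ Δ : Path h} {j} → Supported Γ → FlipAt m (rPath E Γ) Δ j →
      ∃ λ Γ′ → FlipAt n Γ Γ′ j × rPath E Γ′ ≡ Δ
    FlipAt-lift {Γ = Γ} {Δ} {j} sΓ flip@(1≤j , _ , _ , Δ-path , same-vertex , _) =
      lift Δ , from (FlipAt-rPath⇔ sΓ (lift-supported Δ Δ-path Δ-starts))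
                 (subst (λ Θ → FlipAt m (rPath E Γ) Θ j) (sym (rPath-lift Δ Δ-path Δ-starts)) flip) ,
      rPath-lift Δ Δ-path Δ-starts
      where
      Δ-starts : vertex Δ zero ≡ rPerm E x₀
      Δ-starts = trans (same-vertex zero (<⇒≢ 1≤j)) (trans (rPath-vertex Γ zero) (cong (rPerm E) (starts sΓ)))

    FlipAt-rPath : ∀ {h} {Γ Γ′ : Path h} {j} → Supported Γ → FlipAt n Γ Γ′ j → FlipAt m (rPath E Γ) (rPath E Γ′) j
    FlipAt-rPath {Γ′ = Γ′} sΓ flip = to (FlipAt-rPath⇔ sΓ (Supported-flip {Γ′ = Γ′} sΓ flip)) flip

    Supported-step : ∀ {h} (Γ Γ′ : Path h) → Supported Γ → FlipStep n Γ Γ′ → Supported Γ′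
    Supported-step _ Γ′ sΓ (_ , flip) = Supported-flip {Γ′ = Γ′} sΓ flip

    FlipStep-rPath : ∀ {h} (Γ Γ′ : Path h) → Supported Γ → FlipStep n Γ Γ′ → FlipStep m (rPath E Γ) (rPath E Γ′)
    FlipStep-rPath _ Γ′ sΓ (j , flip) = j , FlipAt-rPath {Γ′ = Γ′} sΓ flip

    FlipStep-lift : ∀ {h} (Γ Δ : Path h) → Supported Γ → FlipStep m (rPath E Γ) Δ →
      ∃ λ Γ′ → FlipStep n Γ Γ′ × rPath E Γ′ ≡ Δ
    FlipStep-lift _ Δ sΓ (j , flip) with FlipAt-lift {Δ = Δ} sΓ flip
    ... | Γ′ , flip′ , eq = Γ′ , (j , flip′) , eq

-- The flipclass of Γ₀

module FlipclassRestriction (n h : ℕ) (Γ₀ : Path h) (Γ₀-path : IsPath n Γ₀) where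

  moved-by-labels : ℕ → Bool
  moved-by-labels x = any (movesᵇ x) (toList (ls Γ₀))

  open Restriction n moved-by-labels public
  open From (Vec.head (vs Γ₀)) (proj₁ Γ₀-path) public
  open StarSimulation {R = FlipStep n} {S = FlipStep m} (Supported {h}) (rPath E)
    Supported-step FlipStep-rPath FlipStep-lift public

  F : Path h → Set
  F = Flipclass n Γ₀

  Γ₀-labels-in-E : ∀ i → TrIn E (label Γ₀ i)
  Γ₀-labels-in-E i =
    in-E (<-trans a<b b<n) (inj₁ (≡⇒≡ᵇ (a t) (a t) refl)) , in-E b<n (inj₂ (≡⇒≡ᵇ (b t) (b t) refl))
    where
    t = label Γ₀ i
    a<b = proj₁ (proj₁ (proj₂ Γ₀-path i))
    b<n = proj₂ (proj₁ (proj₂ Γ₀-path i))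
    in-E : ∀ {x} → x < n → T (x ≡ᵇ a t) ⊎ T (x ≡ᵇ b t) → x ∈ E
    in-E x<n moves = ∈-filter⁺ (T? ∘ moved-by-labels) (∈-upTo⁺ x<n)
      (any⁺ _ (Any.map (λ { refl → from T-∨ moves }) (∈-toList⁺ (∈-lookup i (ls Γ₀)))))

  Γ₀-supported : Supported Γ₀
  Γ₀-supported = record
    { isPath = Γ₀-path ; starts = sym (head≡vertex-zero Γ₀) ; labels-in = Γ₀-labels-in-E }

  supported : ∀ {Γ} → F Γ → Supported Γ
  supported = Star-P Γ₀-supported

  VS-injective : ∀ x y → VS F x → VS F y → rPerm E x ≡ rPerm E y → x ≡ y
  VS-injective x y (Γ , Γ∈F , k , refl) (Δ , Δ∈F , l , refl) =
    rPerm-injective-on (Supported-reachable (supported Γ∈F) k) (Supported-reachable (supported Δ∈F) l)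

  LS-in-E : ∀ {t} → LS F t → TrIn E t
  LS-in-E (Γ , Γ∈F , i , refl) = Supported.labels-in (supported Γ∈F) i

  open PathImage (rPerm E) (rTr E) F public

  pullback-⇔ : ∀ (_≼_ : Tr → Tr → Set) {t u} → TrIn E t → TrIn E u → (t ≼ u) ⇔ pullback E _≼_ (rTr E t) (rTr E u)
  pullback-⇔ _≼_ t∈ u∈ = mk⇔ (subst₂ _≼_ (sym (liftTr-rTr t∈)) (sym (liftTr-rTr u∈)))
                              (subst₂ _≼_ (liftTr-rTr t∈) (liftTr-rTr u∈))

  Increasing-labels⇔ : ∀ (_≼_ : Tr → Tr → Set) {ts} → All (LS F) ts →
    Increasing _≼_ ts ⇔ Increasing (pullback E _≼_) (map (rTr E) ts)
  Increasing-labels⇔ _≼_ ts∈ = Increasing-map⇔ (rTr E) (pullback-⇔ _≼_) (All.map LS-in-E ts∈)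

  IncPath⇔ : ∀ (_≼_ : Tr → Tr → Set) Γ → F Γ → IncPath _≼_ Γ ⇔ IncPath (pullback E _≼_) (rPath E Γ)
  IncPath⇔ _≼_ Γ Γ∈F =
    subst (λ us → IncPath _≼_ Γ ⇔ Increasing (pullback E _≼_) us) (sym (toList-map (rTr E) (ls Γ)))
    (Increasing-labels⇔ _≼_ (toList⁺ (lookup⁻ λ i → Γ , Γ∈F , i , refl)))

  Increasing-steps⇔ : ∀ (_≼_ : Tr → Tr → Set) {V : Set} (st : List (Tr × V)) → All (LS F) (map proj₁ st) →
    Increasing _≼_ (map proj₁ st) ⇔ Increasing (pullback E _≼_) (map (λ s → rTr E (proj₁ s)) st)
  Increasing-steps⇔ _≼_ st st∈ = subst (λ us → Increasing _≼_ (map proj₁ st) ⇔ Increasing (pullback E _≼_) us)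
    (sym (map-∘ st)) (Increasing-labels⇔ _≼_ st∈)

  iso : FlipclassIso n m F F′ (rPerm E) (rTr E)
  iso = record
    { f-inj  = VS-injective
    ; f-onto = VS-image⇔
    ; g-inj  = λ t u t∈ u∈ → rTr-injective (LS-in-E t∈) (LS-in-E u∈)
    ; g-onto = LS-image⇔
    ; paths  = λ Γ Γ∈F → Γ , Γ∈F , refl
    ; p-inj  = λ Γ Δ Γ∈F Δ∈F → rPath-injective (supported Γ∈F) (supported Δ∈F)
    ; p-onto = λ Δ Δ∈F′ → Δ∈F′
    ; flips  = λ Γ Γ′ j Γ∈F → FlipAt-rPath {Γ′ = Γ′} (supported Γ∈F)
    ; g-mono = λ t u t∈ u∈ → rTr-LexLe (LS-in-E t∈) (LS-in-E u∈)
    }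

lemma6p9 : (n h : ℕ) (Γ₀ : Path h) → IsPath n Γ₀ →
  let E  = Elist n Γ₀
      m  = length E
      F  = Flipclass n Γ₀
      F' = Image (rPath E) F
      rv = rPerm E
      rt = rTr E
      rv₂ : List ℕ × ℕ → List ℕ × ℕ
      rv₂ = λ p → rv (proj₁ p) , Data.Product.proj₂ p
  in
  -- (1) F' is a flipclass of 𝔖ₘ ...
  (Σ (Path h) λ Δ₀ → IsPath m Δ₀ × (∀ Δ → F' Δ ⇔ Flipclass m Δ₀ Δ)) ×
  -- ... r_E : F → F' is a bijection (onto by definition of F') ...
  (∀ Γ Δ → F Γ → F Δ → rPath E Γ ≡ rPath E Δ → Γ ≡ Δ) ×
  -- ... commuting with the flip operators ...
  (∀ Γ Γ' j → F Γ → FlipAt n Γ Γ' j → FlipAt m (rPath E Γ) (rPath E Γ') j) ×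
  -- ... and r_E (l_i Γ) = l_i (r_E Γ)
  (∀ Γ → F Γ → ∀ (i : Fin h) → rt (lookup (ls Γ) i) ≡ lookup (ls (rPath E Γ)) i) ×
  -- (2) r_E induces an isomorphism S_F → S_F' of edge-labelled digraphs ...
  ((∀ x y → VS F x → VS F y → rv x ≡ rv y → x ≡ y) ×
   (∀ x' → VS F' x' ⇔ (∃ λ x → VS F x × rv x ≡ x')) ×
   (∀ x t y → ES F x t y → ES F' (rv x) (rt t) (rv y)) ×
   (∀ x t' y → VS F x → VS F y → ES F' (rv x) t' (rv y) →
      ∃ λ t → ES F x t y × rt t ≡ t')) ×
  -- ... and an isomorphism TS_F → TS_F'  ((x , i) ↦ (r_E x , i))
  ((∀ p q → TVS F p → TVS F q → rv₂ p ≡ rv₂ q → p ≡ q) ×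
   (∀ p' → TVS F' p' ⇔ (∃ λ p → TVS F p × rv₂ p ≡ p')) ×
   (∀ p t q → TES F p t q → TES F' (rv₂ p) (rt t) (rv₂ q)) ×
   (∀ p t' q → TVS F p → TVS F q → TES F' (rv₂ p) t' (rv₂ q) →
      ∃ λ t → TES F p t q × rt t ≡ t')) ×
  -- (3) increasing paths correspond, for every reflection ordering ≼
  (∀ (_≼_ : Tr → Tr → Set) → ReflectionOrdering n _≼_ →
    (∀ Γ → F Γ → IncPath _≼_ Γ ⇔ IncPath (pullback E _≼_) (rPath E Γ)) ×
    (∀ x st → Walk (ES F) x st →
       Increasing _≼_ (map proj₁ st) ⇔ Increasing (pullback E _≼_) (map (λ s → rt (proj₁ s)) st)) ×
    (∀ p st → Walk (TES F) p st →
       Increasing _≼_ (map proj₁ st) ⇔ Increasing (pullback E _≼_) (map (λ s → rt (proj₁ s)) st))) ×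
  -- (4) r_E induces an isomorphism of flipclasses F → F'
  FlipclassIso n m F F' rv rt
lemma6p9 n h Γ₀ Γ₀-path =
  (rPath E Γ₀ , rPath-IsPath Γ₀-supported , Star-image⇔ Γ₀-supported) ,
  FlipclassIso.p-inj iso ,
  FlipclassIso.flips iso ,
  (λ Γ _ i → sym (rPath-label Γ i)) ,
  (VS-injective , VS-image⇔ , ES-image , ES-image⁻ VS-injective) ,
  (f₂-injective VS-injective , TVS-image⇔ , TES-image , TES-image⁻ VS-injective) ,
  -- (3) holds for every relation ≼.
  (λ _≼_ _ →
    IncPath⇔ _≼_ ,
    (λ x st walk → Increasing-steps⇔ _≼_ st (Walk-ES-labels x st walk)) ,
    (λ p st walk → Increasing-steps⇔ _≼_ st (Walk-TES-labels p st walk))) ,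
  iso
  where open FlipclassRestriction n h Γ₀ Γ₀-path
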